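{- Let $n$ be an even integer, $k$ an integer with $1 \leq k \leq n/2-1$, $m=(n-2k)/2$, and let $G_{n,k}$ be the convex geometric graph defined in the context. For every edge $e \in E(G_{n,k})$, the open arc $Arc_e$ contains at least $m-1$ vertices of $V(G)$. Furthermore, if $e$ emanates from a positive-labelled vertex, then $Arc_e$ contains at least $m$ vertices of $V(G)$.
   Context: Let $P$ be a regular $2n$-gon inscribed in a circle, whose vertices are labelled cyclically by $-n+1,\dots,0,\dots,n$; labels are taken modulo $2n$ with representatives in $\{ -n+1,\dots,n\}$ (e.g. the vertex labelled $t$ is the point at angle $\pi t/n$). For even $n$, the vertex set $V(G)$ is the set of the $n$ odd-labelled vertices of $P$. An edge $\{a,b\}$ is in direction $i$ if $a+b \equiv 2i \pmod{2n}$. For an integer $i$ and an integer $j$ with $0 \leq j \leq n-2k$ and $j \equiv i \pmod 2$, let $B_{i,j} = \{\,\{i-d,\,i+d\} : d = n-2k-j+1+2t,\ t=0,\dots,k-1\,\}$ (labels mod $2n$): the $k$ consecutive edges in direction $i$ leaving exactly $j$ vertices of $V(G)$ on the side away from vertex $i$. The graph $G_{n,k}$ has vertex set $V(G)$ and edge set $\bigcup_{j=-m}^{m} B_{j,|j|} \cup \bigcup_{i=0}^{2k} B_{m+i,\,m-\epsilon_i}$, where $\epsilon_i=0$ for even $i$ and $\epsilon_i=1$ for odd $i$. For an edge $e$, its endpoints divide the circle into two open arcs; $Arc_e$ denotes the one not containing the point of $P$ labelled $n$ (equivalently, not containing the open boundary edge between the vertices $n-1$ and $-(n-1)$). An edge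 $[a,b]$ (labels in $\{ -n+1,\dots,n\}$) emanates from $a$ if $|a|>|b|$; if $a=-b$, it emanates from its positive-labelled endpoint. -}

module Defs where

open import Data.Bool using (Bool; true; false; if_then_else_; _∧_)
open import Data.Nat as ℕ using (ℕ; zero; suc; _∸_; ⌊_/2⌋; _<ᵇ_; _≡ᵇ_)
open import Data.Integer as ℤ using (ℤ; +_; _-_; _%ℕ_; ∣_∣)
open import Data.List using (List; []; _∷_; map; upTo; concat; filterᵇ; length)
open import Data.Product using (_×_; _,_)

-- Residue of an integer label modulo 2n, in {0, ..., 2n-1}.
-- (The n = 0 case never occurs in the statement; it is given a dummy value.)
cyc : ℕ → ℤ → ℕ
cyc zero    x = 0
cyc (suc p) x = x %ℕ (2 ℕ.* suc p)

rep : ℕ → ℤ → ℤ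
rep n x = (+ cyc n (x ℤ.+ + (n ∸ 1))) - + (n ∸ 1)

-- All labels -n+1, ..., n of the 2n-gon P.
labels : ℕ → List ℤ
labels n = map (λ i → + i - + (n ∸ 1)) (upTo (2 ℕ.* n))

isOdd : ℤ → Bool
isOdd x = ∣ x ∣ ℕ.% 2 ≡ᵇ 1

VG : ℕ → List ℤ
VG n = filterᵇ isOdd (labels n)

-- Edges are (unordered) pairs of labels, stored as ordered pairs.
Edge : Set
Edge = ℤ × ℤ

B : ℕ → ℕ → ℤ → ℕ → List Edge
B n k i j = map (λ t → let d = + (n ∸ (2 ℕ.* k) ∸ j ℕ.+ 1 ℕ.+ 2 ℕ.* t)
                       in rep n (i - d) , rep n (i ℤ.+ d))
                (upTo k)

half : ℕ → ℕ → ℕ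
half n k = ⌊ (n ∸ 2 ℕ.* k) /2⌋

ε : ℕ → ℕ
ε i = i ℕ.% 2

-- E(G_{n,k}) = ⋃_{j=-m}^{m} B_{j,|j|} ∪ ⋃_{i=0}^{2k} B_{m+i, m-ε_i},  m = (n-2k)/2.
edges : ℕ → ℕ → List Edge
edges n k =
  concat (map (λ s → let j = + s - + m in B n k j ∣ j ∣) (upTo (2 ℕ.* m ℕ.+ 1)))
  Data.List.++
  concat (map (λ i → B n k (+ (m ℕ.+ i)) (m ∸ ε i)) (upTo (2 ℕ.* k ℕ.+ 1)))
  where m = half n k

-- c lies on the open arc going counterclockwise (increasing labels) from a to b.
onArc : ℕ → ℤ → ℤ → ℤ → Bool
onArc n a b c = (0 <ᵇ cyc n (c - a)) ∧ (cyc n (c - a) <ᵇ cyc n (b - a))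

inArcE : ℕ → Edge → ℤ → Bool
inArcE n (a , b) c =
  if onArc n a b (+ n) then onArc n b a c else onArc n a b c

arcCount : ℕ → Edge → ℕ
arcCount n e = length (filterᵇ (inArcE n e) (VG n))

-- The endpoint from which e emanates: the one with larger absolute value;
-- if a = -b, the positive-labelled endpoint.
source : Edge → ℤ
source (a , b) =
  if ∣ b ∣ <ᵇ ∣ a ∣ then a
  else if ∣ a ∣ <ᵇ ∣ b ∣ then b
  else (if isPos a then a else b)
  where
  isPos : ℤ → Bool
  isPos (+ zero)  = false
  isPos (+ suc x) = true
  isPos _     = false

module Submission where

open import Defs
open import Data.Nat using (ℕ; _≤_; _∸_; ⌊_/2⌋; _*_)
open import Data.Nat.Divisibility using (_∣_)
open import Data.Integer as ℤ using (+_)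
open import Data.List.Membership.Propositional using (_∈_)
open import Data.Product using (_×_)

open import Data.Bool using (Bool; true; false; T; _∧_; if_then_else_)
open import Data.Bool.Properties using (T-∧; T-≡)
open import Data.Nat as ℕ using (zero; suc; _+_; _<_; _<ᵇ_; z≤n; s≤s)
open import Data.Nat.Properties
open import Data.Nat.Divisibility using (divides)
open import Data.Nat.DivMod using (m<n⇒m%n≡m; [m+kn]%n≡m%n; [m+n]%n≡m%n; m*n%n≡0)
open import Data.Nat.Tactic.RingSolver using (solve)
open import Data.Integer as ℤ using (ℤ; -[1+_]; _-_; _⊖_)
import Data.Integer.Properties as ℤP
import Data.Integer.Tactic.RingSolver as ℤRing
open import Data.List using (List; []; _∷_; applyUpTo; filterᵇ; length; map; upTo; concat)
open import Data.List.Membership.Propositional.Properties using (∈-++⁻; ∈-concat⁻′; ∈-map⁻; ∈-upTo⁻)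
open import Data.List.Properties using (map-upTo)
open import Data.Product using (_,_; ∃; proj₁; proj₂)
open import Data.Sum using (_⊎_; inj₁; inj₂)
open import Data.Empty using (⊥-elim)
open import Function using (_∘_; Equivalence)
open import Relation.Binary.PropositionalEquality
open import Relation.Nullary using (yes; no; ¬_)

-- Write n = N1 + 1.  When N1 is odd, the odd labels 2u - N1 (0 ≤ u ≤ N1)
-- are exactly the vertices of V(G), listed counterclockwise by their index u.
--   1. Geometry of a single chord (ThreeVertices, chord-contains): if u < v < w are
--      vertex indices, then whichever way round the chord {u, w} is listed, Arc_e is the
--      counterclockwise arc from u to w (the point n lies on the other side), so it
--      contains v.  Counting every other label of P gives chord-count: a chord joining
--      the vertices u and u + δ + 1 has at least δ vertices on its arc.
--   2. A chord of P with centre c and half-width d reduces either to a chord that does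
--      not pass the point n (inner-chord-count, δ = d - 1) or to one whose upper end wraps
--      past n (outer-chord-count, δ = n - d - 1).
--   3. With m = (n - 2k)/2 and the t-th chord of a bundle (k = t + κ + 1), the central
--      bundles B_{j,|j|} never wrap and have at least m vertices on their arcs; the side
--      bundles B_{m+i, m-ε_i} have at least m, except the wrapped odd ones with κ = 0,
--      which have m - 1 vertices but both ends in the negative half, so no positive source.
--   4. The theorem follows by splitting an edge of G_{n,k} into these cases.

<-by-gap : ∀ {a b} g → b ≡ suc (a + g) → a < b
<-by-gap {a} g refl = s≤s (m≤m+n a g)

≤-by-gap : ∀ {a b} g → b ≡ a + g → a ≤ b
≤-by-gap {a} g refl = m≤m+n a g

≤⇒<ᵇ≡false : ∀ {a b} → b ≤ a → (a <ᵇ b) ≡ false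
≤⇒<ᵇ≡false {a}     {zero}  _         = refl
≤⇒<ᵇ≡false {suc a} {suc b} (s≤s b≤a) = ≤⇒<ᵇ≡false b≤a

positive-difference : ∀ d y → + (d + y) - + y ≡ + d
positive-difference d y = begin
  + (d + y) - + y      ≡⟨ ℤP.[+m]-[+n]≡m⊖n (d + y) y ⟩
  (d + y) ⊖ y          ≡⟨ cong₂ _⊖_ (+-comm d y) (sym (+-identityʳ y)) ⟩
  (y + d) ⊖ (y + 0)    ≡⟨ ℤP.+-cancelˡ-⊖ y d 0 ⟩
  + d                  ∎
  where open ≡-Reasoning

negative-difference : ∀ d x → + x - + (suc d + x) ≡ -[1+ d ]
negative-difference d x = begin
  + x - + (suc d + x)        ≡⟨ ℤP.[+m]-[+n]≡m⊖n x (suc d + x) ⟩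
  x ⊖ (suc d + x)            ≡⟨ cong₂ _⊖_ (sym (+-identityʳ x)) (+-comm (suc d) x) ⟩
  (x + 0) ⊖ (x + suc d)      ≡⟨ ℤP.+-cancelˡ-⊖ x 0 (suc d) ⟩
  -[1+ d ]                   ∎
  where open ≡-Reasoning

cyc-diff : ∀ {N1} x y r → x ≡ r + y → r < 2 * suc N1 → cyc (suc N1) (+ x - + y) ≡ r
cyc-diff x y r refl r<2n rewrite positive-difference r y = m<n⇒m%n≡m r<2n

cyc-diff-wrap : ∀ {N1} x y r d → y ≡ suc d + x → 2 * suc N1 ≡ suc r + suc d →
  cyc (suc N1) (+ x - + y) ≡ suc r
cyc-diff-wrap {N1} x y r d refl 2n≡ rewrite negative-difference d x
  | m<n⇒m%n≡m (<-by-gap {suc d} {2 * suc N1} r (trans 2n≡ (cong suc (+-comm r (suc d)))))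
  = trans (cong (_∸ suc d) 2n≡) (m+n∸n≡m (suc r) (suc d))

-- Vertices.  For N1 = n - 1 the vertex with index u (0 ≤ u ≤ N1) carries the label 2u - N1;
-- when N1 is odd these are exactly the odd labels -N1, -N1 + 2, ..., N1.
lab : ℕ → ℕ → ℤ
lab N1 u = + (2 * u) - + N1

odd-abs : ∀ x a → ℤ.∣ x ∣ ≡ suc (2 * a) → T (isOdd x)
odd-abs x a eq = subst (λ r → T (r ℕ.≡ᵇ 1)) (sym parity) _
  where parity : ℤ.∣ x ∣ ℕ.% 2 ≡ 1
        parity = trans (cong (ℕ._% 2) (trans eq (cong suc (*-comm 2 a)))) ([m+kn]%n≡m%n 1 a 2)

vertex-odd : ∀ q v → T (isOdd (lab (suc (2 * q)) v))
vertex-odd q v with v ≤? q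
... | yes v≤q with i , refl ← m≤n⇒∃[o]m+o≡n v≤q =
  odd-abs (lab (suc (2 * q)) v) i
    (cong ℤ.∣_∣ (trans (cong (λ y → + (2 * v) - + y) shape) (negative-difference (2 * i) (2 * v))))
  where shape : suc (2 * (v + i)) ≡ suc (2 * i) + 2 * v
        shape = solve (v ∷ i ∷ [])
... | no v≰q with i , refl ← m≤n⇒∃[o]m+o≡n (≰⇒> v≰q) =
  odd-abs (lab (suc (2 * q)) v) i
    (cong ℤ.∣_∣ (trans (cong (λ x → + x - + suc (2 * q)) shape) (positive-difference (suc (2 * i)) (suc (2 * q)))))
  where shape : 2 * (suc q + i) ≡ suc (2 * i) + suc (2 * q)
        shape = solve (q ∷ i ∷ [])

filterᵇ-filterᵇ : ∀ {A : Set} (p q : A → Bool) xs →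
  filterᵇ q (filterᵇ p xs) ≡ filterᵇ (λ x → p x ∧ q x) xs
filterᵇ-filterᵇ p q [] = refl
filterᵇ-filterᵇ p q (x ∷ xs) with p x
... | false = filterᵇ-filterᵇ p q xs
... | true with q x
...   | false = filterᵇ-filterᵇ p q xs
...   | true  = cong (x ∷_) (filterᵇ-filterᵇ p q xs)

filterᵇ-length-∷ : ∀ {A : Set} (p : A → Bool) x xs →
  length (filterᵇ p xs) ≤ length (filterᵇ p (x ∷ xs))
filterᵇ-length-∷ p x xs with p x
... | false = ≤-refl
... | true  = n≤1+n _

count-every-other : ∀ {A : Set} (p : A → Bool) (h : ℕ → A) a δ L → a + 2 * δ ≤ L →
  (∀ j → j < δ → T (p (h (a + 2 * j)))) → δ ≤ length (filterᵇ p (applyUpTo h L))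
count-every-other p h a       zero    L       _  _   = z≤n
count-every-other p h zero    (suc δ) zero    () _
count-every-other p h (suc a) (suc δ) zero    () _
count-every-other p h zero    (suc δ) (suc L) le hit with p (h 0) | hit 0 (s≤s z≤n)
... | true | _ = s≤s (count-every-other p (h ∘ suc) 1 δ L
                       (≤-pred (subst (_≤ suc L) (*-suc 2 δ) le))
                       (λ j j<δ → subst (λ i → T (p (h i))) (*-suc 2 j) (hit (suc j) (s≤s j<δ))))
count-every-other p h (suc a) (suc δ) (suc L) le hit =
  ≤-trans (count-every-other p (h ∘ suc) a (suc δ) L (≤-pred le) hit)
          (filterᵇ-length-∷ p (h 0) (applyUpTo (h ∘ suc) L))

-- Lower bound for arcCount: δ consecutive vertices u + 1, ..., u + δ lying on Arc_e.
-- (Here n = N1 + 1 with N1 = 2q + 1 odd, so V(G) is the set of all vertex labels.)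
consecutive-vertices-in-arc : ∀ q e u δ → u + δ ≤ suc (2 * q) →
  (∀ j → j < δ → T (inArcE (suc (suc (2 * q))) e (lab (suc (2 * q)) (u + suc j)))) →
  δ ≤ arcCount (suc (suc (2 * q))) e
consecutive-vertices-in-arc q e u δ u+δ≤N1 inArc =
  subst (δ ≤_) (sym arcCount-tabulated)
    (count-every-other (λ x → isOdd x ∧ inArcE n e x) label (2 + 2 * u) δ (2 * n)
      (subst (_≤ 2 * n) (sym last-index) (*-monoʳ-≤ 2 (s≤s u+δ≤N1)))
      (λ j j<δ → subst (λ x → T (isOdd x ∧ inArcE n e x)) (sym (label-index j))
                   (Equivalence.from T-∧ (vertex-odd q (u + suc j) , inArc j j<δ))))
  where
  N1 n : ℕ
  N1 = suc (2 * q)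
  n = suc N1
  label : ℕ → ℤ
  label i = + i - + N1
  arcCount-tabulated : arcCount n e ≡ length (filterᵇ (λ x → isOdd x ∧ inArcE n e x) (applyUpTo label (2 * n)))
  arcCount-tabulated = cong length (trans (cong (λ xs → filterᵇ (inArcE n e) (filterᵇ isOdd xs)) (map-upTo label (2 * n)))
                                          (filterᵇ-filterᵇ isOdd (inArcE n e) (applyUpTo label (2 * n))))
  last-index : 2 + 2 * u + 2 * δ ≡ 2 * suc (u + δ)
  last-index = solve (u ∷ δ ∷ [])
  label-index : ∀ j → label (2 + 2 * u + 2 * j) ≡ lab N1 (u + suc j)
  label-index j = cong (λ x → + x - + N1) index
    where index : 2 + 2 * u + 2 * j ≡ 2 * (u + suc j)
          index = solve (u ∷ j ∷ [])

lab-difference : ∀ N1 a b → lab N1 a - lab N1 b ≡ + (2 * a) - + (2 * b)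
lab-difference N1 a b = shift (+ (2 * a)) (+ (2 * b)) (+ N1)
  where shift : ∀ (x y c : ℤ) → (x - c) - (y - c) ≡ x - y
        shift = ℤRing.solve-∀

top-minus-lab : ∀ N1 a → + suc N1 - lab N1 a ≡ + (suc N1 + N1) - + (2 * a)
top-minus-lab N1 a = shift (+ suc N1) (+ (2 * a)) (+ N1)
  where shift : ∀ (t x c : ℤ) → t - (x - c) ≡ (t ℤ.+ c) - x
        shift = ℤRing.solve-∀

<ᵇ≡true : ∀ {a b} → a < b → (a <ᵇ b) ≡ true
<ᵇ≡true a<b = Equivalence.to T-≡ (<⇒<ᵇ a<b)

-- The arc of the chord {u, w} avoiding the point n is the counterclockwise arc from
-- u to w, whichever endpoint is listed first; in particular it contains v.
module ThreeVertices (u γ η ρ : ℕ) where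
  v w N1 n : ℕ
  v  = suc (u + γ)
  w  = suc (v + η)
  N1 = w + ρ
  n  = suc N1

  cyc-vu : cyc n (lab N1 v - lab N1 u) ≡ 2 * suc γ
  cyc-vu = trans (cong (cyc n) (lab-difference N1 v u))
                 (cyc-diff {N1} (2 * v) (2 * u) (2 * suc γ) eq (<-by-gap {2 * suc γ} (suc (2 * (u + suc η + ρ))) gap))
    where eq : 2 * (suc (u + γ)) ≡ 2 * suc γ + 2 * u
          eq = solve (u ∷ γ ∷ [])
          gap : 2 * suc (suc (suc (u + γ) + η) + ρ) ≡ suc (2 * suc γ + suc (2 * (u + suc η + ρ)))
          gap = solve (u ∷ γ ∷ η ∷ ρ ∷ [])

  cyc-wu : cyc n (lab N1 w - lab N1 u) ≡ 2 * (suc γ + suc η)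
  cyc-wu = trans (cong (cyc n) (lab-difference N1 w u))
                 (cyc-diff {N1} (2 * w) (2 * u) _ eq (<-by-gap {2 * (suc γ + suc η)} (suc (2 * (u + ρ))) gap))
    where eq : 2 * (suc (suc (u + γ) + η)) ≡ 2 * (suc γ + suc η) + 2 * u
          eq = solve (u ∷ γ ∷ η ∷ [])
          gap : 2 * suc (suc (suc (u + γ) + η) + ρ) ≡ suc (2 * (suc γ + suc η) + suc (2 * (u + ρ)))
          gap = solve (u ∷ γ ∷ η ∷ ρ ∷ [])

  cyc-nu : cyc n (+ n - lab N1 u) ≡ suc (2 * (suc γ + suc η + ρ))
  cyc-nu = trans (cong (cyc n) (top-minus-lab N1 u))
                 (cyc-diff {N1} (n + N1) (2 * u) _ eq (<-by-gap {suc (2 * (suc γ + suc η + ρ))} (2 * u) gap))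
    where eq : suc (suc (suc (u + γ) + η) + ρ + (suc (suc (u + γ) + η) + ρ)) ≡ suc (2 * (suc γ + suc η + ρ)) + 2 * u
          eq = solve (u ∷ γ ∷ η ∷ ρ ∷ [])
          gap : 2 * suc (suc (suc (u + γ) + η) + ρ) ≡ suc (suc (2 * (suc γ + suc η + ρ)) + 2 * u)
          gap = solve (u ∷ γ ∷ η ∷ ρ ∷ [])

  cyc-nw : cyc n (+ n - lab N1 w) ≡ suc (2 * ρ)
  cyc-nw = trans (cong (cyc n) (top-minus-lab N1 w))
                 (cyc-diff {N1} (n + N1) (2 * w) _ eq (<-by-gap {suc (2 * ρ)} (2 * w) gap))
    where eq : suc (suc (suc (u + γ) + η) + ρ + (suc (suc (u + γ) + η) + ρ)) ≡ suc (2 * ρ) + 2 * (suc (suc (u + γ) + η))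
          eq = solve (u ∷ γ ∷ η ∷ ρ ∷ [])
          gap : 2 * suc (suc (suc (u + γ) + η) + ρ) ≡ suc (suc (2 * ρ) + 2 * (suc (suc (u + γ) + η)))
          gap = solve (u ∷ γ ∷ η ∷ ρ ∷ [])

  cyc-uw : cyc n (lab N1 u - lab N1 w) ≡ suc (suc (2 * (u + ρ)))
  cyc-uw = trans (cong (cyc n) (lab-difference N1 u w))
                 (cyc-diff-wrap {N1} (2 * u) (2 * w) _ (suc (2 * γ + 2 * suc η)) eq total)
    where eq : 2 * (suc (suc (u + γ) + η)) ≡ suc (suc (2 * γ + 2 * suc η)) + 2 * u
          eq = solve (u ∷ γ ∷ η ∷ [])
          total : 2 * suc (suc (suc (u + γ) + η) + ρ) ≡ suc (suc (2 * (u + ρ))) + suc (suc (2 * γ + 2 * suc η))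
          total = solve (u ∷ γ ∷ η ∷ ρ ∷ [])

  v-between : onArc n (lab N1 u) (lab N1 w) (lab N1 v) ≡ true
  v-between rewrite cyc-vu | cyc-wu = <ᵇ≡true (<-by-gap {2 * suc γ} (suc (2 * η)) gap)
    where gap : 2 * (suc γ + suc η) ≡ suc (2 * suc γ + suc (2 * η))
          gap = solve (γ ∷ η ∷ [])

  n-not-u→w : onArc n (lab N1 u) (lab N1 w) (+ n) ≡ false
  n-not-u→w rewrite cyc-nu | cyc-wu = ≤⇒<ᵇ≡false (≤-trans (*-monoʳ-≤ 2 (m≤m+n (suc γ + suc η) ρ)) (n≤1+n _))

  n-on-w→u : onArc n (lab N1 w) (lab N1 u) (+ n) ≡ true
  n-on-w→u rewrite cyc-nw | cyc-uw = <ᵇ≡true (<-by-gap {suc (2 * ρ)} (2 * u) gap)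
    where gap : suc (suc (2 * (u + ρ))) ≡ suc (suc (2 * ρ) + 2 * u)
          gap = solve (u ∷ ρ ∷ [])

  chord-contains : T (inArcE n (lab N1 u , lab N1 w) (lab N1 v)) × T (inArcE n (lab N1 w , lab N1 u) (lab N1 v))
  chord-contains rewrite n-not-u→w | n-on-w→u | v-between = _ , _

chord-contains : ∀ {N1 u v w} → u < v → v < w → w ≤ N1 →
  T (inArcE (suc N1) (lab N1 u , lab N1 w) (lab N1 v)) × T (inArcE (suc N1) (lab N1 w , lab N1 u) (lab N1 v))
chord-contains {u = u} u<v v<w w≤N1
  with γ , refl ← m≤n⇒∃[o]m+o≡n u<v
  with η , refl ← m≤n⇒∃[o]m+o≡n v<w
  with ρ , refl ← m≤n⇒∃[o]m+o≡n w≤N1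
  = ThreeVertices.chord-contains u γ η ρ

chord-count : ∀ q u δ → u + suc δ ≤ suc (2 * q) →
  let N1 = suc (2 * q) in
  δ ≤ arcCount (suc N1) (lab N1 u , lab N1 (u + suc δ))
  × δ ≤ arcCount (suc N1) (lab N1 (u + suc δ) , lab N1 u)
chord-count q u δ w≤N1 =
  consecutive-vertices-in-arc q _ u δ u+δ≤N1 (λ j j<δ → proj₁ (between j j<δ)) ,
  consecutive-vertices-in-arc q _ u δ u+δ≤N1 (λ j j<δ → proj₂ (between j j<δ))
  where
  u+δ≤N1 : u + δ ≤ suc (2 * q)
  u+δ≤N1 = ≤-trans (+-monoʳ-≤ u (n≤1+n δ)) w≤N1
  between : ∀ j → j < δ →
    T (inArcE (suc (suc (2 * q))) (lab (suc (2 * q)) u , lab (suc (2 * q)) (u + suc δ)) (lab (suc (2 * q)) (u + suc j)))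
    × T (inArcE (suc (suc (2 * q))) (lab (suc (2 * q)) (u + suc δ) , lab (suc (2 * q)) u) (lab (suc (2 * q)) (u + suc j)))
  between j j<δ = chord-contains (m<m+n u (s≤s z≤n)) (+-monoʳ-< u (s≤s j<δ)) w≤N1

chord : ℕ → ℤ → ℕ → Edge
chord n c d = rep n (c - + d) , rep n (c ℤ.+ + d)

rep-vertex : ∀ N1 x u → x ℤ.+ + N1 ≡ + (2 * u) → u ≤ N1 → rep (suc N1) x ≡ lab N1 u
rep-vertex N1 x u eq u≤N1 rewrite eq =
  cong (λ r → + r - + N1) (m<n⇒m%n≡m (*-monoʳ-< 2 (s≤s u≤N1)))

rep-vertex-wrap : ∀ N1 x u → x ℤ.+ + N1 ≡ + (2 * u + 2 * suc N1) → u ≤ N1 → rep (suc N1) x ≡ lab N1 u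
rep-vertex-wrap N1 x u eq u≤N1 rewrite eq =
  cong (λ r → + r - + N1) (trans ([m+n]%n≡m%n (2 * u) (2 * suc N1)) (m<n⇒m%n≡m (*-monoʳ-< 2 (s≤s u≤N1))))

chord-ends : ∀ (c : ℤ) d N1 → (c ℤ.+ + d) ℤ.+ + N1 ≡ ((c - + d) ℤ.+ + N1) ℤ.+ (+ d ℤ.+ + d)
chord-ends c d N1 = shift c (+ d) (+ N1)
  where shift : ∀ (x y z : ℤ) → (x ℤ.+ y) ℤ.+ z ≡ ((x - y) ℤ.+ z) ℤ.+ (y ℤ.+ y)
        shift = ℤRing.solve-∀

inner-chord-ends : ∀ q (c : ℤ) u δ → let N1 = suc (2 * q) in
  (c - + suc δ) ℤ.+ + N1 ≡ + (2 * u) → u + suc δ ≤ N1 →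
  chord (suc N1) c (suc δ) ≡ (lab N1 u , lab N1 (u + suc δ))
inner-chord-ends q c u δ low w≤N1 =
  cong₂ _,_ (rep-vertex N1 (c - + suc δ) u low (≤-trans (m≤m+n u (suc δ)) w≤N1))
            (rep-vertex N1 (c ℤ.+ + suc δ) (u + suc δ) high w≤N1)
  where
  N1 : ℕ
  N1 = suc (2 * q)
  double : 2 * u + (suc δ + suc δ) ≡ 2 * (u + suc δ)
  double = solve (u ∷ δ ∷ [])
  high : (c ℤ.+ + suc δ) ℤ.+ + N1 ≡ + (2 * (u + suc δ))
  high = trans (chord-ends c (suc δ) N1) (trans (cong (ℤ._+ (+ suc δ ℤ.+ + suc δ)) low) (cong +_ double))

outer-chord-ends : ∀ q (c : ℤ) d u δ → let N1 = suc (2 * q) in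
  (c - + d) ℤ.+ + N1 ≡ + (2 * (u + suc δ)) → suc δ + d ≡ suc N1 → u + suc δ ≤ N1 →
  chord (suc N1) c d ≡ (lab N1 (u + suc δ) , lab N1 u)
outer-chord-ends q c d u δ low width w≤N1 =
  cong₂ _,_ (rep-vertex N1 (c - + d) (u + suc δ) low w≤N1)
            (rep-vertex-wrap N1 (c ℤ.+ + d) u high (≤-trans (m≤m+n u (suc δ)) w≤N1))
  where
  N1 : ℕ
  N1 = suc (2 * q)
  double : 2 * (u + suc δ) + (d + d) ≡ 2 * u + 2 * (suc δ + d)
  double = solve (u ∷ δ ∷ d ∷ [])
  high : (c ℤ.+ + d) ℤ.+ + N1 ≡ + (2 * u + 2 * suc N1)
  high = trans (chord-ends c d N1) (trans (cong (ℤ._+ (+ d ℤ.+ + d)) low)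
           (cong +_ (trans double (cong (λ m → 2 * u + 2 * m) width))))

inner-chord-count : ∀ q (c : ℤ) u δ → let N1 = suc (2 * q) in
  (c - + suc δ) ℤ.+ + N1 ≡ + (2 * u) → u + suc δ ≤ N1 →
  δ ≤ arcCount (suc N1) (chord (suc N1) c (suc δ))
inner-chord-count q c u δ low w≤N1 =
  subst (λ e → δ ≤ arcCount (suc (suc (2 * q))) e) (sym (inner-chord-ends q c u δ low w≤N1))
        (proj₁ (chord-count q u δ w≤N1))

outer-chord-count : ∀ q (c : ℤ) d u δ → let N1 = suc (2 * q) in
  (c - + d) ℤ.+ + N1 ≡ + (2 * (u + suc δ)) → suc δ + d ≡ suc N1 → u + suc δ ≤ N1 →
  δ ≤ arcCount (suc N1) (chord (suc N1) c d)
outer-chord-count q c d u δ low width w≤N1 =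
  subst (λ e → δ ≤ arcCount (suc (suc (2 * q))) e) (sym (outer-chord-ends q c d u δ low width w≤N1))
        (proj₂ (chord-count q u δ w≤N1))

lower-end : ∀ (c : ℤ) d N1 x → c ℤ.+ + N1 ≡ + (x + d) → (c - + d) ℤ.+ + N1 ≡ + x
lower-end c d N1 x eq = begin
  (c - + d) ℤ.+ + N1   ≡⟨ swap c (+ d) (+ N1) ⟩
  (c ℤ.+ + N1) - + d   ≡⟨ cong (_- + d) eq ⟩
  + (x + d) - + d      ≡⟨ positive-difference x d ⟩
  + x                  ∎
  where
  open ≡-Reasoning
  swap : ∀ (x y z : ℤ) → (x - y) ℤ.+ z ≡ (x ℤ.+ z) - y
  swap = ℤRing.solve-∀

shifted-centre : ∀ a b N1 y → a + N1 ≡ y + b → (+ a - + b) ℤ.+ + N1 ≡ + y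
shifted-centre a b N1 y eq = begin
  (+ a - + b) ℤ.+ + N1   ≡⟨ swap (+ a) (+ b) (+ N1) ⟩
  + (a + N1) - + b       ≡⟨ cong (λ x → + x - + b) eq ⟩
  + (y + b) - + b        ≡⟨ positive-difference y b ⟩
  + y                    ∎
  where
  open ≡-Reasoning
  swap : ∀ (x y z : ℤ) → (x - y) ℤ.+ z ≡ (x ℤ.+ z) - y
  swap = ℤRing.solve-∀

Bounds : ℕ → ℕ → Edge → Set
Bounds n m e = (m ∸ 1 ≤ arcCount n e) × (+ 0 ℤ.< source e → m ≤ arcCount n e)

at-least-m : ∀ n m e → m ≤ arcCount n e → Bounds n m e
at-least-m n m e m≤ = ≤-trans (m∸n≤m _ 1) m≤ , λ _ → m≤

source-endpoint : ∀ a b → source (a , b) ≡ a ⊎ source (a , b) ≡ b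
source-endpoint a b with ℤ.∣ b ∣ <ᵇ ℤ.∣ a ∣ | ℤ.∣ a ∣ <ᵇ ℤ.∣ b ∣
... | true  | _     = inj₁ refl
... | false | true  = inj₂ refl
... | false | false = if-branch _
  where if-branch : ∀ c → (if c then a else b) ≡ a ⊎ (if c then a else b) ≡ b
        if-branch true  = inj₁ refl
        if-branch false = inj₂ refl

negative-vertex : ∀ N1 v → 2 * v < N1 → ¬ (+ 0 ℤ.< lab N1 v)
negative-vertex N1 v 2v<N1 with g , refl ← m≤n⇒∃[o]m+o≡n 2v<N1 =
  ℤP.+≮- ∘ subst (+ 0 ℤ.<_) label
  where label : lab (suc (2 * v + g)) v ≡ -[1+ g ]
        label = trans (cong (λ y → + (2 * v) - + suc y) (+-comm (2 * v) g)) (negative-difference g (2 * v))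

lower-chord-source : ∀ N1 a b → 2 * a < N1 → 2 * b < N1 → ¬ (+ 0 ℤ.< source (lab N1 a , lab N1 b))
lower-chord-source N1 a b 2a<N1 2b<N1 0<src with source-endpoint (lab N1 a) (lab N1 b)
... | inj₁ src≡a = negative-vertex N1 a 2a<N1 (subst (+ 0 ℤ.<_) src≡a 0<src)
... | inj₂ src≡b = negative-vertex N1 b 2b<N1 (subst (+ 0 ℤ.<_) src≡b 0<src)

-- The central bundles B_{j,|j|}, -m ≤ j ≤ m, have centre j = s - m with 0 ≤ s ≤ 2m; the t-th
-- chord has half-width m + min(s, 2m - s) + 1 + 2t.  Below, n = 2m + 2k with k = t + κ + 1.
central-width-right : ∀ j r t → 2 * (j + r) ∸ ℤ.∣ + (j + r + j) - + (j + r) ∣ + 1 + 2 * t ≡ suc (j + 2 * r + 2 * t)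
central-width-right j r t = begin
  2 * (j + r) ∸ ℤ.∣ + (j + r + j) - + (j + r) ∣ + 1 + 2 * t ≡⟨ cong (λ x → 2 * (j + r) ∸ x + 1 + 2 * t) distance ⟩
  2 * (j + r) ∸ j + 1 + 2 * t                              ≡⟨ cong (λ x → x ∸ j + 1 + 2 * t) twice ⟩
  j + (j + 2 * r) ∸ j + 1 + 2 * t                          ≡⟨ cong (λ x → x + 1 + 2 * t) (m+n∸m≡n j (j + 2 * r)) ⟩
  j + 2 * r + 1 + 2 * t                                    ≡⟨ tidy ⟩
  suc (j + 2 * r + 2 * t)                                  ∎
  where
  open ≡-Reasoning
  distance : ℤ.∣ + (j + r + j) - + (j + r) ∣ ≡ j
  distance = cong ℤ.∣_∣ (trans (cong (λ x → + x - + (j + r)) (+-comm (j + r) j)) (positive-difference j (j + r)))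
  twice : 2 * (j + r) ≡ j + (j + 2 * r)
  twice = solve (j ∷ r ∷ [])
  tidy : j + 2 * r + 1 + 2 * t ≡ suc (j + 2 * r + 2 * t)
  tidy = solve (j ∷ r ∷ t ∷ [])

central-width-left : ∀ s i t → 2 * suc (s + i) ∸ ℤ.∣ + s - + suc (s + i) ∣ + 1 + 2 * t ≡ suc (s + suc (s + i) + 2 * t)
central-width-left s i t = begin
  2 * suc (s + i) ∸ ℤ.∣ + s - + suc (s + i) ∣ + 1 + 2 * t ≡⟨ cong (λ x → 2 * suc (s + i) ∸ x + 1 + 2 * t) distance ⟩
  2 * suc (s + i) ∸ suc i + 1 + 2 * t                    ≡⟨ cong (λ x → x ∸ suc i + 1 + 2 * t) twice ⟩
  suc i + (s + suc (s + i)) ∸ suc i + 1 + 2 * t          ≡⟨ cong (λ x → x + 1 + 2 * t) (m+n∸m≡n (suc i) (s + suc (s + i))) ⟩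
  s + suc (s + i) + 1 + 2 * t                            ≡⟨ tidy ⟩
  suc (s + suc (s + i) + 2 * t)                          ∎
  where
  open ≡-Reasoning
  distance : ℤ.∣ + s - + suc (s + i) ∣ ≡ suc i
  distance = cong ℤ.∣_∣ (trans (cong (λ x → + s - + suc x) (+-comm s i)) (negative-difference i s))
  twice : 2 * suc (s + i) ≡ suc i + (s + suc (s + i))
  twice = solve (s ∷ i ∷ [])
  tidy : s + suc (s + i) + 1 + 2 * t ≡ suc (s + suc (s + i) + 2 * t)
  tidy = solve (s ∷ i ∷ t ∷ [])

-- Centre j ≥ 0 (m = j + r, s = m + j): the chord starts at the vertex j + κ and does not
-- pass the point n; its arc holds j + 2r + 2t ≥ m vertices.
central-chord-right : ∀ j r t κ → let N1 = suc (2 * (j + r + t + κ)) in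
  j + r ≤ arcCount (suc N1) (chord (suc N1) (+ (j + r + j) - + (j + r)) (suc (j + 2 * r + 2 * t)))
central-chord-right j r t κ =
  ≤-trans (≤-by-gap (r + 2 * t) m≤δ)
    (inner-chord-count (j + r + t + κ) (+ (j + r + j) - + (j + r)) (j + κ) (j + 2 * r + 2 * t)
      (lower-end (+ (j + r + j) - + (j + r)) (suc (j + 2 * r + 2 * t)) N1 _ (shifted-centre (j + r + j) (j + r) N1 _ low))
      (≤-by-gap κ bound))
  where
  N1 : ℕ
  N1 = suc (2 * (j + r + t + κ))
  m≤δ : j + 2 * r + 2 * t ≡ j + r + (r + 2 * t)
  m≤δ = solve (j ∷ r ∷ t ∷ [])
  low : j + r + j + suc (2 * (j + r + t + κ)) ≡ 2 * (j + κ) + suc (j + 2 * r + 2 * t) + (j + r)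
  low = solve (j ∷ r ∷ t ∷ κ ∷ [])
  bound : suc (2 * (j + r + t + κ)) ≡ j + κ + suc (j + 2 * r + 2 * t) + κ
  bound = solve (j ∷ r ∷ t ∷ κ ∷ [])

-- Centre -(i + 1) < 0 (m = s + i + 1): the chord starts at the vertex κ and does not pass
-- the point n; its arc holds m + s + 2t ≥ m vertices.
central-chord-left : ∀ s i t κ → let N1 = suc (2 * (suc (s + i) + t + κ)) in
  suc (s + i) ≤ arcCount (suc N1) (chord (suc N1) (+ s - + suc (s + i)) (suc (s + suc (s + i) + 2 * t)))
central-chord-left s i t κ =
  ≤-trans (≤-by-gap (s + 2 * t) m≤δ)
    (inner-chord-count (suc (s + i) + t + κ) (+ s - + suc (s + i)) κ (s + suc (s + i) + 2 * t)
      (lower-end (+ s - + suc (s + i)) (suc (s + suc (s + i) + 2 * t)) N1 _ (shifted-centre s (suc (s + i)) N1 _ low))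
      (≤-by-gap (suc (i + κ)) bound))
  where
  N1 : ℕ
  N1 = suc (2 * (suc (s + i) + t + κ))
  m≤δ : s + suc (s + i) + 2 * t ≡ suc (s + i) + (s + 2 * t)
  m≤δ = solve (s ∷ i ∷ t ∷ [])
  low : s + suc (2 * (suc (s + i) + t + κ)) ≡ 2 * κ + suc (s + suc (s + i) + 2 * t) + suc (s + i)
  low = solve (s ∷ i ∷ t ∷ κ ∷ [])
  bound : suc (2 * (suc (s + i) + t + κ)) ≡ κ + suc (s + suc (s + i) + 2 * t) + suc (i + κ)
  bound = solve (s ∷ i ∷ t ∷ κ ∷ [])

central-chord : ∀ m t κ s → s ≤ 2 * m →
  let N1 = suc (2 * (m + t + κ)) in
  m ≤ arcCount (suc N1) (chord (suc N1) (+ s - + m) (2 * m ∸ ℤ.∣ + s - + m ∣ + 1 + 2 * t))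
central-chord m t κ s s≤2m with m ≤? s
... | yes m≤s with j , refl ← m≤n⇒∃[o]m+o≡n m≤s
              with r , refl ← m≤n⇒∃[o]m+o≡n (+-cancelˡ-≤ m j m (subst (m + j ≤_) (cong (λ x → m + x) (+-identityʳ m)) s≤2m)) =
  subst (λ d → j + r ≤ arcCount (suc (suc (2 * (j + r + t + κ)))) (chord (suc (suc (2 * (j + r + t + κ)))) (+ (j + r + j) - + (j + r)) d))
        (sym (central-width-right j r t)) (central-chord-right j r t κ)
... | no m≰s with i , refl ← m≤n⇒∃[o]m+o≡n (≰⇒> m≰s) =
  subst (λ d → suc (s + i) ≤ arcCount (suc (suc (2 * (suc (s + i) + t + κ)))) (chord (suc (suc (2 * (suc (s + i) + t + κ)))) (+ s - + suc (s + i)) d))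
        (sym (central-width-left s i t)) (central-chord-left s i t κ)

gap-≤ : ∀ κ ω t → κ + ω < suc (t + κ) → ω ≤ t
gap-≤ κ ω t lt = +-cancelˡ-≤ κ ω t (subst (κ + ω ≤_) (+-comm t κ) (≤-pred lt))

-- Side chords with even offset i = 2h (centre m + 2h, half-width m + 2t + 1), for
-- n = 2m + 2k, k = t + κ + 1, 2h ≤ 2k.  If h ≤ κ the chord does not pass the point n and
-- has m + 2t vertices on its arc; otherwise it wraps around and has m + 2κ.
even-side-chord : ∀ m t κ h → h ≤ suc (t + κ) →
  let N1 = suc (2 * (m + t + κ)) in
  m ≤ arcCount (suc N1) (chord (suc N1) (+ (m + 2 * h)) (suc (m + 2 * t)))
even-side-chord m t κ h h≤k with h ≤? κ
... | yes h≤κ with σ , refl ← m≤n⇒∃[o]m+o≡n h≤κ =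
  ≤-trans (m≤m+n m (2 * t))
    (inner-chord-count (m + t + (h + σ)) (+ (m + 2 * h)) (h + m + (h + σ)) (m + 2 * t)
      (lower-end (+ (m + 2 * h)) (suc (m + 2 * t)) (suc (2 * (m + t + (h + σ)))) _ (cong +_ low)) (≤-by-gap σ bound))
  where
  low : m + 2 * h + suc (2 * (m + t + (h + σ))) ≡ 2 * (h + m + (h + σ)) + suc (m + 2 * t)
  low = solve (m ∷ t ∷ h ∷ σ ∷ [])
  bound : suc (2 * (m + t + (h + σ))) ≡ h + m + (h + σ) + suc (m + 2 * t) + σ
  bound = solve (m ∷ t ∷ h ∷ σ ∷ [])
... | no h≰κ with ω , refl ← m≤n⇒∃[o]m+o≡n (≰⇒> h≰κ)
             with τ , refl ← m≤n⇒∃[o]m+o≡n (gap-≤ κ ω t h≤k) =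
  ≤-trans (m≤m+n m (2 * κ))
    (outer-chord-count (m + (ω + τ) + κ) (+ (m + 2 * suc (κ + ω))) (suc (m + 2 * (ω + τ))) ω (m + 2 * κ)
      (lower-end (+ (m + 2 * suc (κ + ω))) (suc (m + 2 * (ω + τ))) (suc (2 * (m + (ω + τ) + κ))) _ (cong +_ low))
      width (≤-by-gap (m + ω + 2 * τ) bound))
  where
  low : m + 2 * suc (κ + ω) + suc (2 * (m + (ω + τ) + κ)) ≡ 2 * (ω + suc (m + 2 * κ)) + suc (m + 2 * (ω + τ))
  low = solve (m ∷ κ ∷ ω ∷ τ ∷ [])
  width : suc (m + 2 * κ) + suc (m + 2 * (ω + τ)) ≡ suc (suc (2 * (m + (ω + τ) + κ)))
  width = solve (m ∷ κ ∷ ω ∷ τ ∷ [])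
  bound : suc (2 * (m + (ω + τ) + κ)) ≡ ω + suc (m + 2 * κ) + (m + ω + 2 * τ)
  bound = solve (m ∷ κ ∷ ω ∷ τ ∷ [])

-- For the odd side chords that wrap around (below) the ends are the vertices ω and
-- ω + m + 2κ; when κ = 0 both lie in the lower half, so the edge has no positive source.
wrapped-bound : ∀ m1 κ ω τ → ω + suc (m1 + 2 * κ) ≤ suc (2 * (suc m1 + (ω + τ) + κ))
wrapped-bound m1 κ ω τ = ≤-by-gap (m1 + ω + 2 * τ + 2) gap
  where gap : suc (2 * (suc m1 + (ω + τ) + κ)) ≡ ω + suc (m1 + 2 * κ) + (m1 + ω + 2 * τ + 2)
        gap = solve (m1 ∷ κ ∷ ω ∷ τ ∷ [])

wrapped-bounds : ∀ m1 κ ω τ → let N1 = suc (2 * (suc m1 + (ω + τ) + κ)) in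
  Bounds (suc N1) (suc m1) (lab N1 (ω + suc (m1 + 2 * κ)) , lab N1 ω)
wrapped-bounds m1 zero ω τ =
  ≤-trans (m≤m+n m1 (2 * 0)) (proj₂ (chord-count (suc m1 + (ω + τ) + 0) ω (m1 + 2 * 0) (wrapped-bound m1 0 ω τ))) ,
  ⊥-elim ∘ lower-chord-source N1 (ω + suc (m1 + 2 * 0)) ω (<-by-gap (2 * τ) far) (<-by-gap (2 * (m1 + τ) + 2) near)
  where
  N1 : ℕ
  N1 = suc (2 * (suc m1 + (ω + τ) + 0))
  far : suc (2 * (suc m1 + (ω + τ) + 0)) ≡ suc (2 * (ω + suc (m1 + 2 * 0)) + 2 * τ)
  far = solve (m1 ∷ ω ∷ τ ∷ [])
  near : suc (2 * (suc m1 + (ω + τ) + 0)) ≡ suc (2 * ω + (2 * (m1 + τ) + 2))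
  near = solve (m1 ∷ ω ∷ τ ∷ [])
wrapped-bounds m1 (suc κ) ω τ =
  at-least-m (suc N1) (suc m1) (lab N1 (ω + suc (m1 + 2 * suc κ)) , lab N1 ω) (≤-trans (≤-by-gap (suc (2 * κ)) more)
                      (proj₂ (chord-count (suc m1 + (ω + τ) + suc κ) ω (m1 + 2 * suc κ) (wrapped-bound m1 (suc κ) ω τ))))
  where
  N1 : ℕ
  N1 = suc (2 * (suc m1 + (ω + τ) + suc κ))
  more : m1 + 2 * suc κ ≡ suc m1 + suc (2 * κ)
  more = solve (m1 ∷ κ ∷ [])

-- Side chords with odd offset i = 2h + 1 (centre m + 2h + 1, half-width m + 2t + 2), for
-- n = 2m + 2k, k = t + κ + 1, 2h + 1 ≤ 2k and m = m1 + 1.  If h < κ the chord does not pass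
-- the point n and has m + 2t + 1 vertices on its arc; otherwise it wraps around and is
-- handled by wrapped-bounds.
odd-side-chord : ∀ m1 t κ h → h < suc (t + κ) →
  let N1 = suc (2 * (suc m1 + t + κ)) in
  Bounds (suc N1) (suc m1) (chord (suc N1) (+ (suc m1 + suc (2 * h))) (suc (suc (suc m1 + 2 * t))))
odd-side-chord m1 t κ h h<k with suc h ≤? κ
... | yes h<κ with σ , refl ← m≤n⇒∃[o]m+o≡n h<κ =
  at-least-m (suc N1) (suc m1) (chord (suc N1) (+ (suc m1 + suc (2 * h))) (suc (suc (suc m1 + 2 * t))))
    (≤-trans (≤-trans (m≤m+n (suc m1) (2 * t)) (n≤1+n _))
      (inner-chord-count (suc m1 + t + (suc h + σ)) (+ (suc m1 + suc (2 * h))) (h + suc m1 + (suc h + σ)) (suc (suc m1 + 2 * t))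
        (lower-end (+ (suc m1 + suc (2 * h))) (suc (suc (suc m1 + 2 * t))) N1 _ (cong +_ low)) (≤-by-gap σ bound)))
  where
  N1 : ℕ
  N1 = suc (2 * (suc m1 + t + (suc h + σ)))
  low : suc m1 + suc (2 * h) + suc (2 * (suc m1 + t + (suc h + σ))) ≡ 2 * (h + suc m1 + (suc h + σ)) + suc (suc (suc m1 + 2 * t))
  low = solve (m1 ∷ t ∷ h ∷ σ ∷ [])
  bound : suc (2 * (suc m1 + t + (suc h + σ))) ≡ h + suc m1 + (suc h + σ) + suc (suc (suc m1 + 2 * t)) + σ
  bound = solve (m1 ∷ t ∷ h ∷ σ ∷ [])
... | no h≮κ with ω , refl ← m≤n⇒∃[o]m+o≡n (≤-pred (≰⇒> h≮κ))
             with τ , refl ← m≤n⇒∃[o]m+o≡n (gap-≤ κ ω t h<k) =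
  subst (Bounds (suc N1) (suc m1)) (sym ends) (wrapped-bounds m1 κ ω τ)
  where
  N1 : ℕ
  N1 = suc (2 * (suc m1 + (ω + τ) + κ))
  low : suc m1 + suc (2 * (κ + ω)) + suc (2 * (suc m1 + (ω + τ) + κ)) ≡ 2 * (ω + suc (m1 + 2 * κ)) + suc (suc (suc m1 + 2 * (ω + τ)))
  low = solve (m1 ∷ κ ∷ ω ∷ τ ∷ [])
  width : suc (m1 + 2 * κ) + suc (suc (suc m1 + 2 * (ω + τ))) ≡ suc (suc (2 * (suc m1 + (ω + τ) + κ)))
  width = solve (m1 ∷ κ ∷ ω ∷ τ ∷ [])
  ends : chord (suc N1) (+ (suc m1 + suc (2 * (κ + ω)))) (suc (suc (suc m1 + 2 * (ω + τ))))
         ≡ (lab N1 (ω + suc (m1 + 2 * κ)) , lab N1 ω)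
  ends = outer-chord-ends (suc m1 + (ω + τ) + κ) (+ (suc m1 + suc (2 * (κ + ω)))) (suc (suc (suc m1 + 2 * (ω + τ)))) ω (m1 + 2 * κ)
           (lower-end (+ (suc m1 + suc (2 * (κ + ω)))) (suc (suc (suc m1 + 2 * (ω + τ)))) N1 _ (cong +_ low))
           width (wrapped-bound m1 κ ω τ)

parity : ∀ i → (∃ λ h → i ≡ 2 * h) ⊎ (∃ λ h → i ≡ suc (2 * h))
parity zero = inj₁ (0 , refl)
parity (suc i) with parity i
... | inj₁ (h , refl) = inj₂ (h , refl)
... | inj₂ (h , refl) = inj₁ (suc h , sym (*-suc 2 h))

even-side-width : ∀ m1 t h → 2 * suc m1 ∸ (suc m1 ∸ ε (2 * h)) + 1 + 2 * t ≡ suc (suc m1 + 2 * t)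
even-side-width m1 t h = begin
  2 * suc m1 ∸ (suc m1 ∸ ε (2 * h)) + 1 + 2 * t  ≡⟨ cong (λ x → 2 * suc m1 ∸ (suc m1 ∸ x) + 1 + 2 * t) even ⟩
  2 * suc m1 ∸ suc m1 + 1 + 2 * t                ≡⟨ cong (λ x → x ∸ suc m1 + 1 + 2 * t) twice ⟩
  suc m1 + suc m1 ∸ suc m1 + 1 + 2 * t           ≡⟨ cong (λ x → x + 1 + 2 * t) (m+n∸m≡n (suc m1) (suc m1)) ⟩
  suc m1 + 1 + 2 * t                             ≡⟨ tidy ⟩
  suc (suc m1 + 2 * t)                           ∎
  where
  open ≡-Reasoning
  even : ε (2 * h) ≡ 0
  even = trans (cong (ℕ._% 2) (*-comm 2 h)) (m*n%n≡0 h 2)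
  twice : 2 * suc m1 ≡ suc m1 + suc m1
  twice = solve (m1 ∷ [])
  tidy : suc m1 + 1 + 2 * t ≡ suc (suc m1 + 2 * t)
  tidy = solve (m1 ∷ t ∷ [])

odd-side-width : ∀ m1 t h → 2 * suc m1 ∸ (suc m1 ∸ ε (suc (2 * h))) + 1 + 2 * t ≡ suc (suc (suc m1 + 2 * t))
odd-side-width m1 t h = begin
  2 * suc m1 ∸ (suc m1 ∸ ε (suc (2 * h))) + 1 + 2 * t  ≡⟨ cong (λ x → 2 * suc m1 ∸ (suc m1 ∸ x) + 1 + 2 * t) odd ⟩
  2 * suc m1 ∸ m1 + 1 + 2 * t                          ≡⟨ cong (λ x → x ∸ m1 + 1 + 2 * t) twice ⟩
  m1 + suc (suc m1) ∸ m1 + 1 + 2 * t                   ≡⟨ cong (λ x → x + 1 + 2 * t) (m+n∸m≡n m1 (suc (suc m1))) ⟩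
  suc (suc m1) + 1 + 2 * t                             ≡⟨ tidy ⟩
  suc (suc (suc m1 + 2 * t))                           ∎
  where
  open ≡-Reasoning
  odd : ε (suc (2 * h)) ≡ 1
  odd = trans (cong (λ x → suc x ℕ.% 2) (*-comm 2 h)) ([m+kn]%n≡m%n 1 h 2)
  twice : 2 * suc m1 ≡ m1 + suc (suc m1)
  twice = solve (m1 ∷ [])
  tidy : suc (suc m1) + 1 + 2 * t ≡ suc (suc (suc m1 + 2 * t))
  tidy = solve (m1 ∷ t ∷ [])

side-chord : ∀ m t κ i → 1 ≤ m → i ≤ 2 * suc (t + κ) →
  let N1 = suc (2 * (m + t + κ)) in
  Bounds (suc N1) m (chord (suc N1) (+ (m + i)) (2 * m ∸ (m ∸ ε i) + 1 + 2 * t))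
side-chord (suc m1) t κ i (s≤s z≤n) i≤2k with parity i
... | inj₁ (h , refl) =
  subst (λ d → Bounds (suc N1) (suc m1) (chord (suc N1) (+ (suc m1 + 2 * h)) d)) (sym (even-side-width m1 t h))
    (at-least-m (suc N1) (suc m1) _ (even-side-chord (suc m1) t κ h (*-cancelˡ-≤ 2 i≤2k)))
  where N1 : ℕ
        N1 = suc (2 * (suc m1 + t + κ))
... | inj₂ (h , refl) =
  subst (λ d → Bounds (suc N1) (suc m1) (chord (suc N1) (+ (suc m1 + suc (2 * h))) d)) (sym (odd-side-width m1 t h))
    (odd-side-chord m1 t κ h (*-cancelˡ-< 2 h (suc (t + κ)) i≤2k))
  where N1 : ℕ
        N1 = suc (2 * (suc m1 + t + κ))

polygon-size : ∀ m t κ → 2 * m + 2 * suc (t + κ) ≡ suc (suc (2 * (m + t + κ)))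
polygon-size m t κ = solve (m ∷ t ∷ κ ∷ [])

central-bounds : ∀ n k m s t → n ≡ 2 * m + 2 * k → s ≤ 2 * m → t < k →
  m ≤ arcCount n (chord n (+ s - + m) (n ∸ 2 * k ∸ ℤ.∣ + s - + m ∣ + 1 + 2 * t))
central-bounds _ k m s t refl s≤2m t<k with κ , refl ← m≤n⇒∃[o]m+o≡n t<k
  rewrite m+n∸n≡m (2 * m) (2 * suc (t + κ)) | polygon-size m t κ = central-chord m t κ s s≤2m

side-bounds : ∀ n k m i t → n ≡ 2 * m + 2 * k → 1 ≤ m → i ≤ 2 * k → t < k →
  Bounds n m (chord n (+ (m + i)) (n ∸ 2 * k ∸ (m ∸ ε i) + 1 + 2 * t))
side-bounds _ k m i t refl 1≤m i≤2k t<k with κ , refl ← m≤n⇒∃[o]m+o≡n t<k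
  rewrite m+n∸n≡m (2 * m) (2 * suc (t + κ)) | polygon-size m t κ = side-chord m t κ i 1≤m i≤2k

∈-bundle : ∀ n k c j e → e ∈ B n k c j → ∃ λ t → t < k × e ≡ chord n c (n ∸ 2 * k ∸ j + 1 + 2 * t)
∈-bundle n k c j e e∈B with t , t∈ , refl ← ∈-map⁻ _ e∈B = t , ∈-upTo⁻ t∈ , refl

∈-union : ∀ (f : ℕ → List Edge) N e → e ∈ concat (map f (upTo N)) → ∃ λ s → s < N × e ∈ f s
∈-union f N e e∈ with xs , e∈xs , xs∈ ← ∈-concat⁻′ (map f (upTo N)) e∈
                 with s , s∈ , refl ← ∈-map⁻ f xs∈ = s , ∈-upTo⁻ s∈ , e∈xs

m<n+1⇒m≤n : ∀ {a b} → a < b + 1 → a ≤ b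
m<n+1⇒m≤n {a} {b} a<b+1 = ≤-pred (subst (a <_) (+-comm b 1) a<b+1)

edge-cases : ∀ n k e → e ∈ edges n k →
  let m = half n k in
  (∃ λ s → ∃ λ t → s ≤ 2 * m × t < k × e ≡ chord n (+ s - + m) (n ∸ 2 * k ∸ ℤ.∣ + s - + m ∣ + 1 + 2 * t))
  ⊎ (∃ λ i → ∃ λ t → i ≤ 2 * k × t < k × e ≡ chord n (+ (m + i)) (n ∸ 2 * k ∸ (m ∸ ε i) + 1 + 2 * t))
edge-cases n k e e∈E
  with ∈-++⁻ (concat (map (λ s → B n k (+ s - + half n k) ℤ.∣ + s - + half n k ∣) (upTo (2 * half n k + 1)))) e∈E
... | inj₁ e∈central with s , s< , e∈B ← ∈-union _ (2 * half n k + 1) e e∈central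
                     with t , t<k , refl ← ∈-bundle n k (+ s - + half n k) ℤ.∣ + s - + half n k ∣ e e∈B =
  inj₁ (s , t , m<n+1⇒m≤n s< , t<k , refl)
... | inj₂ e∈side with i , i< , e∈B ← ∈-union _ (2 * k + 1) e e∈side
                  with t , t<k , refl ← ∈-bundle n k (+ (half n k + i)) (half n k ∸ ε i) e e∈B =
  inj₂ (i , t , m<n+1⇒m≤n i< , t<k , refl)

⌊2m/2⌋≡m : ∀ m → ⌊ 2 * m /2⌋ ≡ m
⌊2m/2⌋≡m m = trans (cong ⌊_/2⌋ (*-comm 2 m)) (halve m)
  where halve : ∀ m → ⌊ m * 2 /2⌋ ≡ m
        halve zero    = refl
        halve (suc m) = cong suc (halve m)

positive-below : ∀ {k q} → 1 ≤ k → k ≤ q ∸ 1 → k < q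
positive-below {q = zero}  (s≤s z≤n) ()
positive-below {q = suc q} _         k≤q = s≤s k≤q

polygon-shape : ∀ n k → 2 ∣ n → 1 ≤ k → k ≤ ⌊ n /2⌋ ∸ 1 → 1 ≤ half n k × n ≡ 2 * half n k + 2 * k
polygon-shape _ k (divides q refl) 1≤k k≤n/2-1
  with m1 , refl ← m≤n⇒∃[o]m+o≡n (positive-below {k} {q} 1≤k
                     (subst (λ h → k ≤ h ∸ 1) (trans (cong ⌊_/2⌋ (*-comm q 2)) (⌊2m/2⌋≡m q)) k≤n/2-1))
  = subst (1 ≤_) (sym m≡) (s≤s z≤n) , trans size (cong (λ m → 2 * m + 2 * k) (sym m≡))
  where
  size : suc (k + m1) * 2 ≡ 2 * suc m1 + 2 * k
  size = solve (k ∷ m1 ∷ [])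
  m≡ : half (suc (k + m1) * 2) k ≡ suc m1
  m≡ = trans (cong ⌊_/2⌋ (trans (cong (_∸ 2 * k) size) (m+n∸n≡m (2 * suc m1) (2 * k)))) (⌊2m/2⌋≡m (suc m1))

lemma1 : (n k : ℕ) → 2 ∣ n → 1 ≤ k → k ≤ ⌊ n /2⌋ ∸ 1 →
    (e : Edge) → e ∈ edges n k →
      (half n k ∸ 1 ≤ arcCount n e)
      × ((+ 0) ℤ.< source e → half n k ≤ arcCount n e)
lemma1 n k 2∣n 1≤k k≤n/2-1 e e∈E with polygon-shape n k 2∣n 1≤k k≤n/2-1 | edge-cases n k e e∈E
... | _   , n≡ | inj₁ (s , t , s≤2m , t<k , refl) =
  at-least-m n (half n k) _ (central-bounds n k (half n k) s t n≡ s≤2m t<k)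
... | 1≤m , n≡ | inj₂ (i , t , i≤2k , t<k , refl) = side-bounds n k (half n k) i t n≡ 1≤m i≤2k t<k
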